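{- If $D\in\mathcal{F}$, then the subgraph of $D$ induced on $H_{ab}\cup\{r\}$ has strong diameter $2$.
   Context: An oriented graph is a loopless directed graph with no pair of opposite arcs. A directed graph has strong diameter $2$ if for every ordered pair of distinct vertices $(i,j)$ there is a directed path from $i$ to $j$ of length at most $2$. 2-connected: strong connectivity at least $2$. Paths are simple directed paths; internal vertices are those other than the endpoints. $\mathcal{F}$ is the set of 2-connected oriented graphs $D$ with strong diameter $2$ having six distinct vertices $p,q,a,b,c,r$ such that: arcs $p\to c$, $q\to c$, $q\to b$, $b\to r$, $a\to r$, $p\to a$ are present; every directed path from $p$ to $r$ contains $a$ or contains both $c$ and $b$; every directed path from $q$ to $r$ contains $b$ or contains both $c$ and $a$; every directed path from $c$ to $r$ contains $a$ or $b$. $H_{ab}$ is the set of internal vertices of directed paths from $a$ to $r$ not containing $b$, or from $b$ to $r$ not containing $a$. -}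

module Defs where

open import Data.Nat using (ℕ; _≤_)
open import Data.Fin using (Fin)
open import Data.Bool using (Bool; T)
open import Data.List using (List; []; _∷_)
open import Data.List.Relation.Unary.Unique.Propositional using (Unique)
open import Data.List.Membership.Propositional using (_∈_; _∉_)
open import Data.Product using (Σ; _×_; ∃-syntax)
open import Data.Sum using (_⊎_)
open import Data.Unit using (⊤)
open import Relation.Nullary using (¬_)
open import Relation.Binary.PropositionalEquality using (_≡_; _≢_)

record Digraph (n : ℕ) : Set where
  field
    adj : Fin n → Fin n → Bool

Arc : {n : ℕ} → Digraph n → Fin n → Fin n → Set
Arc D u v = T (Digraph.adj D u v)

data Walk {n : ℕ} (D : Digraph n) : Fin n → Fin n → Set where
  stop : (v : Fin n) → Walk D v v
  step : {u v w : Fin n} → Arc D u v → Walk D v w → Walk D u w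

verts : {n : ℕ} {D : Digraph n} {u v : Fin n} → Walk D u v → List (Fin n)
verts (stop v) = v ∷ []
verts (step {u = u} _ w) = u ∷ verts w

record Path {n : ℕ} (D : Digraph n) (u v : Fin n) : Set where
  constructor mkPath
  field
    walk   : Walk D u v
    simple : Unique (verts walk)

vs : {n : ℕ} {D : Digraph n} {u v : Fin n} → Path D u v → List (Fin n)
vs P = verts (Path.walk P)

Internal : {n : ℕ} {D : Digraph n} {u v : Fin n} → Path D u v → Fin n → Set
Internal {u = u} {v = v} P x = (x ∈ vs P) × (x ≢ u) × (x ≢ v)

Oriented : {n : ℕ} → Digraph n → Set
Oriented {n} D = ((u : Fin n) → ¬ Arc D u u)
               × ((u v : Fin n) → Arc D u v → ¬ Arc D v u)

TwoConnected : {n : ℕ} → Digraph n → Set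
TwoConnected {n} D =
  (3 ≤ n) ×
  ((x u v : Fin n) → u ≢ x → v ≢ x → Σ (Path D u v) (λ P → x ∉ vs P))

InducedStrongDiam2 : {n : ℕ} → Digraph n → (Fin n → Set) → Set
InducedStrongDiam2 {n} D S =
  (i j : Fin n) → S i → S j → i ≢ j →
  Arc D i j ⊎ (∃[ k ] (S k × Arc D i k × Arc D k j))

StrongDiam2 : {n : ℕ} → Digraph n → Set
StrongDiam2 D = InducedStrongDiam2 D (λ _ → ⊤)

record InF {n : ℕ} (D : Digraph n) (p q a b c r : Fin n) : Set where
  field
    oriented  : Oriented D
    twoConn   : TwoConnected D
    diam2     : StrongDiam2 D
    distinct  : Unique (p ∷ q ∷ a ∷ b ∷ c ∷ r ∷ [])
    arc-pc    : Arc D p c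
    arc-qc    : Arc D q c
    arc-qb    : Arc D q b
    arc-br    : Arc D b r
    arc-ar    : Arc D a r
    arc-pa    : Arc D p a
    paths-pr  : (P : Path D p r) → (a ∈ vs P) ⊎ ((c ∈ vs P) × (b ∈ vs P))
    paths-qr  : (P : Path D q r) → (b ∈ vs P) ⊎ ((c ∈ vs P) × (a ∈ vs P))
    paths-cr  : (P : Path D c r) → (a ∈ vs P) ⊎ (b ∈ vs P)

Hab : {n : ℕ} → Digraph n → (a b r : Fin n) → Fin n → Set
Hab D a b r x =
  (Σ (Path D a r) (λ P → (b ∉ vs P) × Internal P x)) ⊎
  (Σ (Path D b r) (λ P → (a ∉ vs P) × Internal P x))

-- Call x unblocked if some x–r path avoids both a and b.  The hypotheses say
-- that p and q are blocked: every path from them to r meets a or b.  By strong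
-- diameter 2, p reaches every unblocked x in two steps, and the middle vertex
-- must be a or b, since otherwise p itself would be unblocked; p → b is
-- excluded by the path p → b → r, so a → x.  Likewise b → x using q.  As D is
-- oriented, no unblocked vertex then has an arc to a or b, so the middle
-- vertex of a two-step path between unblocked vertices is again unblocked.
-- Finally H_ab ∪ {r} is exactly the set of unblocked vertices: a suffix of a
-- path in the definition of H_ab is an unblocked path, and conversely a → x
-- prolongs one into such a path.
module Submission where

open import Defs
open import Data.Nat using (ℕ)
open import Data.Fin using (Fin; _≟_)
open import Data.Sum using (_⊎_; inj₁; inj₂; [_,_])
import Data.Sum as Sum
open import Data.Product using (Σ; _×_; _,_; proj₁; proj₂)
open import Data.Empty using (⊥-elim)
open import Data.List using ([]; _∷_)
open import Data.List.Relation.Unary.All using (All; []; _∷_)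
open import Data.List.Relation.Unary.All.Properties using (¬Any⇒All¬; All¬⇒¬Any)
open import Data.List.Relation.Unary.Any using (here; there; toSum)
open import Data.List.Relation.Unary.AllPairs using ([]; _∷_)
open import Data.List.Relation.Unary.Unique.Propositional using (Unique)
open import Data.List.Membership.Propositional using (_∈_; _∉_)
open import Data.List.Relation.Binary.Subset.Propositional using (_⊆_)
open import Function using (_∘_; id)
open import Relation.Nullary using (¬_; yes; no)
open import Relation.Binary.PropositionalEquality using (_≡_; _≢_; refl; ≢-sym)

module _ {n : ℕ} {D : Digraph n} where

  head∈vs : {u v : Fin n} (P : Path D u v) → u ∈ vs P
  head∈vs (mkPath (stop _) _)   = here refl
  head∈vs (mkPath (step _ _) _) = here refl

  suffix : {u v x : Fin n} (P : Path D u v) → x ∈ vs P →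
           Σ (Path D x v) (λ Q → vs Q ⊆ vs P × (x ≢ u → u ∉ vs Q))
  suffix P@(mkPath (stop _) _)   (here refl) = P , id , λ x≢u _ → x≢u refl
  suffix P@(mkPath (step _ _) _) (here refl) = P , id , λ x≢u _ → x≢u refl
  suffix (mkPath (step _ w) (u∉w ∷ simple)) (there x∈w) =
    let Q , Q⊆w , _ = suffix (mkPath w simple) x∈w
    in  Q , there ∘ Q⊆w , λ _ u∈Q → All¬⇒¬Any u∉w (Q⊆w u∈Q)

  prepend : {s u v : Fin n} → Arc D s u → (P : Path D u v) → s ∉ vs P → Path D s v
  prepend s→u (mkPath w simple) s∉P = mkPath (step s→u w) (¬Any⇒All¬ _ s∉P ∷ simple)

  two-step⇒¬every-path-meets : {s m t u v : Fin n} → Unique (s ∷ m ∷ t ∷ []) →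
                               All (u ≢_) (s ∷ m ∷ t ∷ []) → All (v ≢_) (s ∷ m ∷ t ∷ []) →
                               Arc D s m → Arc D m t →
                               ¬ ((P : Path D s t) → u ∈ vs P ⊎ v ∈ vs P)
  two-step⇒¬every-path-meets distinct u∉ v∉ s→m m→t meets =
    [ All¬⇒¬Any u∉ , All¬⇒¬Any v∉ ] (meets (mkPath (step s→m (step m→t (stop _))) distinct))

  inducedStrongDiam2-resp : {S T : Fin n → Set} →
                            (∀ {x} → S x → T x) → (∀ {x} → T x → S x) →
                            InducedStrongDiam2 D T → InducedStrongDiam2 D S
  inducedStrongDiam2-resp S⇒T T⇒S diam i j Si Sj i≢j =
    Sum.map₂ (λ (k , Tk , i→k , k→j) → k , T⇒S Tk , i→k , k→j)
             (diam i j (S⇒T Si) (S⇒T Sj) i≢j)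

module Avoidance {n : ℕ} (D : Digraph n) (a b r : Fin n) where

  open import Data.List.Membership.DecPropositional (_≟_ {n}) using (_∈?_)

  Unblocked : Fin n → Set
  Unblocked x = Σ (Path D x r) (λ P → a ∉ vs P × b ∉ vs P)

  Blocked : Fin n → Set
  Blocked s = (P : Path D s r) → a ∈ vs P ⊎ b ∈ vs P

  blocked⇒¬unblocked : {s : Fin n} → Blocked s → ¬ Unblocked s
  blocked⇒¬unblocked blocked (P , a∉P , b∉P) = [ a∉P , b∉P ] (blocked P)

  unblocked⇒≢a : {x : Fin n} → Unblocked x → x ≢ a
  unblocked⇒≢a (P , a∉P , _) refl = a∉P (head∈vs P)

  unblocked-extend : {k x : Fin n} → Arc D k x → k ≢ a → k ≢ b → Unblocked x → Unblocked k
  unblocked-extend {k} k→x k≢a k≢b (P , a∉P , b∉P) with k ∈? vs P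
  ... | yes k∈P = let Q , Q⊆P , _ = suffix P k∈P in Q , a∉P ∘ Q⊆P , b∉P ∘ Q⊆P
  ... | no k∉P  = prepend k→x P k∉P
                , [ ≢-sym k≢a , a∉P ] ∘ toSum
                , [ ≢-sym k≢b , b∉P ] ∘ toSum

  blocked⇒¬arc-to-unblocked : {s y : Fin n} → Blocked s → s ≢ a → s ≢ b →
                              Arc D s y → ¬ Unblocked y
  blocked⇒¬arc-to-unblocked blocked s≢a s≢b s→y =
    blocked⇒¬unblocked blocked ∘ unblocked-extend s→y s≢a s≢b

  blocked-hub : StrongDiam2 D → {s x : Fin n} → Blocked s → s ≢ a → s ≢ b → Unblocked x →
                (Arc D s a × Arc D a x) ⊎ (Arc D s b × Arc D b x)
  blocked-hub diam {s} {x} blocked s≢a s≢b Ux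
    with diam s x _ _ (λ { refl → blocked⇒¬unblocked blocked Ux })
  ... | inj₁ s→x = ⊥-elim (blocked⇒¬arc-to-unblocked blocked s≢a s≢b s→x Ux)
  ... | inj₂ (k , _ , s→k , k→x) with k ≟ a | k ≟ b
  ...   | yes refl | _        = inj₁ (s→k , k→x)
  ...   | no _     | yes refl = inj₂ (s→k , k→x)
  ...   | no k≢a   | no k≢b   =
    ⊥-elim (blocked⇒¬arc-to-unblocked blocked s≢a s≢b s→k (unblocked-extend k→x k≢a k≢b Ux))

  unblocked-diam2 : StrongDiam2 D → Oriented D →
                    (∀ {x} → Unblocked x → Arc D a x) → (∀ {x} → Unblocked x → Arc D b x) →
                    InducedStrongDiam2 D Unblocked
  unblocked-diam2 diam (_ , antisym) a→ b→ i j Ui Uj i≢j with diam i j _ _ i≢j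
  ... | inj₁ i→j = inj₁ i→j
  ... | inj₂ (k , _ , i→k , k→j) with k ≟ a | k ≟ b
  ...   | yes refl | _        = ⊥-elim (antisym a i (a→ Ui) i→k)
  ...   | no _     | yes refl = ⊥-elim (antisym b i (b→ Ui) i→k)
  ...   | no k≢a   | no k≢b   = inj₂ (k , unblocked-extend k→j k≢a k≢b Uj , i→k , k→j)

  hab-or-r⇒unblocked : a ≢ r → b ≢ r → {x : Fin n} → Hab D a b r x ⊎ x ≡ r → Unblocked x
  hab-or-r⇒unblocked a≢r b≢r (inj₂ refl) =
    mkPath (stop r) ([] ∷ []) , All¬⇒¬Any (a≢r ∷ []) , All¬⇒¬Any (b≢r ∷ [])
  hab-or-r⇒unblocked _ _ (inj₁ (inj₁ (P , b∉P , x∈P , x≢a , _))) =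
    let Q , Q⊆P , a∉Q = suffix P x∈P in Q , a∉Q x≢a , b∉P ∘ Q⊆P
  hab-or-r⇒unblocked _ _ (inj₁ (inj₂ (P , a∉P , x∈P , x≢b , _))) =
    let Q , Q⊆P , b∉Q = suffix P x∈P in Q , a∉P ∘ Q⊆P , b∉Q x≢b

  unblocked⇒hab-or-r : a ≢ b → (∀ {x} → Unblocked x → Arc D a x) →
                       {x : Fin n} → Unblocked x → Hab D a b r x ⊎ x ≡ r
  unblocked⇒hab-or-r a≢b a→ {x} Ux@(P , a∉P , b∉P) with x ≟ r
  ... | yes x≡r = inj₂ x≡r
  ... | no x≢r  = inj₁ (inj₁ ( prepend (a→ Ux) P a∉P
                             , [ ≢-sym a≢b , b∉P ] ∘ toSum
                             , there (head∈vs P) , unblocked⇒≢a Ux , x≢r))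

proposition15 : {n : ℕ} (D : Digraph n) (p q a b c r : Fin n) →
    InF D p q a b c r →
    InducedStrongDiam2 D (λ x → Hab D a b r x ⊎ x ≡ r)
proposition15 D p q a b c r F with InF.distinct F
... | (_ ∷ p≢a ∷ p≢b ∷ p≢c ∷ p≢r ∷ []) ∷ (q≢a ∷ q≢b ∷ q≢c ∷ q≢r ∷ [])
    ∷ (a≢b ∷ a≢c ∷ a≢r ∷ []) ∷ (b≢c ∷ b≢r ∷ []) ∷ (c≢r ∷ []) ∷ [] ∷ [] =
  inducedStrongDiam2-resp (hab-or-r⇒unblocked a≢r b≢r) (unblocked⇒hab-or-r a≢b a→)
                          (unblocked-diam2 diam2 oriented a→ b→)
  where
    open InF F
    open Avoidance D a b r

    ¬p→b : ¬ Arc D p b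
    ¬p→b p→b = two-step⇒¬every-path-meets ((p≢b ∷ p≢r ∷ []) ∷ (b≢r ∷ []) ∷ [] ∷ [])
                 (≢-sym p≢a ∷ a≢b ∷ a≢r ∷ []) (≢-sym p≢c ∷ ≢-sym b≢c ∷ c≢r ∷ [])
                 p→b arc-br (Sum.map₂ proj₁ ∘ paths-pr)

    ¬q→a : ¬ Arc D q a
    ¬q→a q→a = two-step⇒¬every-path-meets ((q≢a ∷ q≢r ∷ []) ∷ (a≢r ∷ []) ∷ [] ∷ [])
                 (≢-sym q≢b ∷ ≢-sym a≢b ∷ b≢r ∷ []) (≢-sym q≢c ∷ ≢-sym a≢c ∷ c≢r ∷ [])
                 q→a arc-ar (Sum.map₂ proj₁ ∘ paths-qr)

    a→ : ∀ {x} → Unblocked x → Arc D a x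
    a→ = [ proj₂ , ⊥-elim ∘ ¬p→b ∘ proj₁ ]
         ∘ blocked-hub diam2 (Sum.map₂ proj₂ ∘ paths-pr) p≢a p≢b

    b→ : ∀ {x} → Unblocked x → Arc D b x
    b→ = [ ⊥-elim ∘ ¬q→a ∘ proj₁ , proj₂ ]
         ∘ blocked-hub diam2 ([ inj₂ , inj₁ ∘ proj₂ ] ∘ paths-qr) q≢a q≢b
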